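{- Let $G$ be a graph of order $n$ with maximum degree $\Delta=\Delta(G)$, and let $k$ be an integer with $\Delta\ge k\ge 1$. Then $$L_k(G)\ >\ \frac{k\,n}{e\,(1+\Delta)^{1+1/k}}.$$
   Context: All graphs are finite, simple and undirected. For a vertex $v$, $N[v]$ denotes the closed neighbourhood of $v$. A vertex set $X\subseteq V(G)$ is a $k$-limited packing if $|N[v]\cap X|\le k$ for every $v\in V(G)$. The $k$-limited packing number $L_k(G)$ is the maximum size of a $k$-limited packing in $G$. $\Delta(G)$ is the maximum vertex degree of $G$, and $e$ is Euler's number. -}

module Defs where

open import Data.Nat using (ℕ; zero; suc; _+_; _*_; _^_; _≤_; _<_; _⊔_; _!)
open import Data.Product using (Σ)
open import Data.Bool using (Bool; true; false)
open import Data.Fin using (Fin)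
open import Data.Fin.Subset using (Subset; ⁅_⁆; _∪_; _∩_; ∣_∣)
open import Data.Vec using (tabulate)
open import Data.List using (foldr; map; allFin)
open import Relation.Binary.PropositionalEquality using (_≡_)

record Graph (n : ℕ) : Set where
  field
    adj       : Fin n → Fin n → Bool
    adj-sym   : ∀ u v → adj u v ≡ adj v u
    adj-irrefl : ∀ v → adj v v ≡ false
open Graph public

nbhd : ∀ {n} → Graph n → Fin n → Subset n
nbhd G v = tabulate (adj G v)

closedNbhd : ∀ {n} → Graph n → Fin n → Subset n
closedNbhd G v = ⁅ v ⁆ ∪ nbhd G v

degree : ∀ {n} → Graph n → Fin n → ℕ
degree G v = ∣ nbhd G v ∣

maxDegree : ∀ {n} → Graph n → ℕ
maxDegree {n} G = foldr _⊔_ 0 (map (degree G) (allFin n))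

IsLimitedPacking : ∀ {n} → Graph n → ℕ → Subset n → Set
IsLimitedPacking G k X = ∀ v → ∣ closedNbhd G v ∩ X ∣ ≤ k

-- expNum k N = N! * Σ_{j=0}^{N} k^j / j!   (a natural number),
-- so expNum k N / N! is the N-th partial sum of the exponential series of e^k.
expNum : ℕ → ℕ → ℕ
expNum k zero    = 1
expNum k (suc N) = suc N * expNum k N + k ^ suc N

-- LtTimesExp B A k :  B < A * e^k  (strict, real inequality)
-- iff some partial sum of the series for e^k already exceeds B / A.
-- (Partial sums strictly increase to e^k.)
LtTimesExp : ℕ → ℕ → ℕ → Set
LtTimesExp B A k = Σ ℕ (λ N → B * (N !) < A * expNum k N)

-- Choose every vertex independently with probability p and delete one vertex of R from each
-- (k + 1)-subset of some N[w] ∩ R: what is left is a k-limited packing, of expected size at least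
-- n p - n C(Δ + 1, k + 1) p^(k + 1).  For rational p = a / b the random choice is derandomised by
-- conditional expectations, the expectations being multiaffine polynomials in the inclusion
-- probabilities.  Taking p just below the optimum ((k + 1) C(Δ + 1, k + 1))^(-1/k) leaves a packing of
-- size at least k n p / (k + 1); then C(Δ + 1, k + 1) ≤ (Δ + 1)^(k + 1) / (k + 1)! and
-- (k + 1)^k / k! < e^k give the bound.
module Submission where

open import Defs
open import Data.Nat using (ℕ; suc; _+_; _*_; _^_; _≤_)
open import Data.Fin.Subset using (Subset; ∣_∣)
open import Data.Product using (Σ; _×_)

open import Data.Empty using (⊥-elim)
open import Data.Fin using (Fin; zero; suc)
open import Data.Fin.Properties using (all?; ¬∀⟶∃¬) renaming (_≟_ to _≟ᶠ_)
open import Data.Fin.Subset using (Side; inside; outside; _∩_; _∪_; _─_; _-_; ⁅_⁆; _∈_; Nonempty)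
open import Data.Fin.Subset.Properties
  using (nonempty?; Empty-unique; ∣⊥∣≡0; ∣⁅x⁆∣≡1; x∈⁅x⁆; x∈p∩q⁻; p⊆p∪q; q⊆p∪q; p⊆q⇒∣p∣≤∣q∣;
         ∣p─q∣≤∣p∣; x∈p∧x≢y⇒x∈p-y; x∈p⇒∣p-x∣<∣p∣)
open import Data.List using (foldr)
open import Data.List.Membership.Propositional using () renaming (_∈_ to _∈ˡ_)
open import Data.List.Membership.Propositional.Properties using (∈-map⁺; ∈-allFin)
open import Data.List.Relation.Unary.Any using (here; there)
open import Data.Nat using (zero; _<_; _!; _⊔_; _≤′_; ≤′-refl; ≤′-step; z≤n; s≤s; z<s; >-nonZero)
open import Data.Nat.Combinatorics using (_C_; k>n⇒nCk≡0; nCk+nC[k+1]≡[n+1]C[k+1])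
open import Data.Nat.Induction using (<-wellFounded)
open import Data.Nat.Properties
open import Algebra.Properties.Semiring.Sum +-*-semiring using (sum-syntax; sum-cong-≗; *-distribˡ-sum)
open import Data.Nat.Tactic.RingSolver using (solve-∀)
open import Data.Product using (∃-syntax; _,_; proj₁; proj₂)
open import Data.Unit using (⊤; tt)
open import Data.Vec as Vec using (Vec; []; _∷_; replicate)
open import Function using (_∘_; case_of_)
open import Induction.WellFounded using (Acc; acc)
open import Relation.Binary.PropositionalEquality
open import Relation.Nullary using (yes; no; contradiction)

-- Binomial coefficients

C-zeroʳ : ∀ n → n C 0 ≡ 1
C-zeroʳ zero    = refl
C-zeroʳ (suc n) = refl

zero-C-suc : ∀ k → 0 C suc k ≡ 0
zero-C-suc k = k>n⇒nCk≡0 (z<s {n = k})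

C-suc-suc : ∀ n k → suc n C suc k ≡ n C k + n C suc k
C-suc-suc n k = sym (nCk+nC[k+1]≡[n+1]C[k+1] n k)

nCk≤[1+n]Ck : ∀ n k → n C k ≤ suc n C k
nCk≤[1+n]Ck n zero    = ≤-reflexive (trans (C-zeroʳ n) (sym (C-zeroʳ (suc n))))
nCk≤[1+n]Ck n (suc k) = ≤-trans (m≤n+m (n C suc k) (n C k)) (≤-reflexive (sym (C-suc-suc n k)))

C-monoˡ-≤ : ∀ k {m n} → m ≤ n → m C k ≤ n C k
C-monoˡ-≤ k m≤n = go (≤⇒≤′ m≤n)
  where
  go : ∀ {m n} → m ≤′ n → m C k ≤ n C k
  go ≤′-refl        = ≤-refl
  go (≤′-step m≤′n) = ≤-trans (go m≤′n) (nCk≤[1+n]Ck _ k)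

k≤n⇒nCk>0 : ∀ {n k} → k ≤ n → 0 < n C k
k≤n⇒nCk>0 {n} {zero} _ = ≤-reflexive (sym (C-zeroʳ n))
k≤n⇒nCk>0 {suc n} {suc k} (s≤s k≤n) =
  ≤-trans (k≤n⇒nCk>0 k≤n) (≤-trans (m≤m+n (n C k) _) (≤-reflexive (sym (C-suc-suc n k))))

k≤n⇒nC[1+k]<[1+n]C[1+k] : ∀ {n k} → k ≤ n → n C suc k < suc n C suc k
k≤n⇒nC[1+k]<[1+n]C[1+k] {n} {k} k≤n =
  subst (n C suc k <_) (sym (C-suc-suc n k)) (m<n+m (n C suc k) (k≤n⇒nCk>0 k≤n))

n^[1+i]+[1+i]*n^i≤[1+n]^[1+i] : ∀ n i → n ^ suc i + suc i * n ^ i ≤ suc n ^ suc i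
n^[1+i]+[1+i]*n^i≤[1+n]^[1+i] n zero = ≤-reflexive (identity n)
  where
  identity : ∀ n → n * 1 + 1 * 1 ≡ suc n * 1
  identity = solve-∀
n^[1+i]+[1+i]*n^i≤[1+n]^[1+i] n (suc i) = begin
    n * (n * x) + suc (suc i) * (n * x)
  ≤⟨ m≤m+n _ (suc i * x) ⟩
    n * (n * x) + suc (suc i) * (n * x) + suc i * x
  ≡⟨ regroup n i x ⟩
    suc n * (n * x + suc i * x)
  ≤⟨ *-monoʳ-≤ (suc n) (n^[1+i]+[1+i]*n^i≤[1+n]^[1+i] n i) ⟩
    suc n * suc n ^ suc i ∎
  where
  open ≤-Reasoning
  x = n ^ i
  regroup : ∀ n i x → n * (n * x) + suc (suc i) * (n * x) + suc i * x ≡ suc n * (n * x + suc i * x)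
  regroup = solve-∀

nCk*k!≤n^k : ∀ n k → (n C k) * k ! ≤ n ^ k
nCk*k!≤n^k n       zero    = ≤-reflexive (cong (_* 1) (C-zeroʳ n))
nCk*k!≤n^k zero    (suc k) = ≤-reflexive (cong (_* suc k !) (zero-C-suc k))
nCk*k!≤n^k (suc n) (suc k) = begin
    (suc n C suc k) * (suc k * k !)
  ≡⟨ cong (_* (suc k * k !)) (C-suc-suc n k) ⟩
    (n C k + n C suc k) * (suc k * k !)
  ≡⟨ distribute (n C k) (n C suc k) k (k !) ⟩
    suc k * ((n C k) * k !) + (n C suc k) * suc k !
  ≤⟨ +-mono-≤ (*-monoʳ-≤ (suc k) (nCk*k!≤n^k n k)) (nCk*k!≤n^k n (suc k)) ⟩
    suc k * n ^ k + n ^ suc k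
  ≡⟨ +-comm (suc k * n ^ k) _ ⟩
    n ^ suc k + suc k * n ^ k
  ≤⟨ n^[1+i]+[1+i]*n^i≤[1+n]^[1+i] n k ⟩
    suc n ^ suc k ∎
  where
  open ≤-Reasoning
  distribute : ∀ a b k f → (a + b) * (suc k * f) ≡ suc k * (a * f) + b * (suc k * f)
  distribute = solve-∀

-- The exponential series

expNum-step : ∀ x k → suc x * expNum x k ≤ expNum x (suc k)
expNum-step x zero = ≤-reflexive (identity x)
  where
  identity : ∀ x → suc x * 1 ≡ 1 * 1 + x * 1
  identity = solve-∀
expNum-step x (suc k) = begin
    suc x * (suc k * e + p)
  ≡⟨ expand x k e p ⟩
    (suc k * e + p) + suc k * (x * e) + x * p
  ≤⟨ +-monoˡ-≤ (x * p) (+-monoʳ-≤ (suc k * e + p) (*-monoʳ-≤ (suc k) x*e≤)) ⟩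
    (suc k * e + p) + suc k * (suc k * e + p) + x * p
  ≡⟨ collect k (suc k * e + p) (x * p) ⟩
    suc (suc k) * (suc k * e + p) + x * p ∎
  where
  open ≤-Reasoning
  e = expNum x k
  p = x ^ suc k
  x*e≤ : x * e ≤ suc k * e + p
  x*e≤ = ≤-trans (m≤n+m (x * e) e) (expNum-step x k)
  expand : ∀ x k e p → suc x * (suc k * e + p) ≡ (suc k * e + p) + suc k * (x * e) + x * p
  expand = solve-∀
  collect : ∀ k E q → E + suc k * E + q ≡ suc (suc k) * E + q
  collect = solve-∀

[1+x]^k≤expNum : ∀ x k → suc x ^ k ≤ expNum x k
[1+x]^k≤expNum x zero    = ≤-refl
[1+x]^k≤expNum x (suc k) = ≤-trans (*-monoʳ-≤ (suc x) ([1+x]^k≤expNum x k)) (expNum-step x k)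

-- This is where e enters: (1 + k)^k / k! lies strictly below the (k+1)-st partial sum of e^k.
[1+k]^k*[1+k]!<k!*expNum : ∀ k → 1 ≤ k → suc k ^ k * suc k ! < k ! * expNum k (suc k)
[1+k]^k*[1+k]!<k!*expNum (suc k) _ = begin-strict
    suc K ^ K * (suc K * K !)
  ≤⟨ *-monoˡ-≤ (suc K * K !) ([1+x]^k≤expNum K K) ⟩
    E * (suc K * K !)
  <⟨ m<m+n (E * (suc K * K !)) (*-mono-≤ (1≤n! K) (m^n>0 K (suc K))) ⟩
    E * (suc K * K !) + K ! * K ^ suc K
  ≡⟨ regroup E (suc K) (K !) (K ^ suc K) ⟩
    K ! * (suc K * E + K ^ suc K) ∎
  where
  open ≤-Reasoning
  K = suc k
  E = expNum K K
  regroup : ∀ E a f p → E * (a * f) + f * p ≡ f * (a * E + p)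
  regroup = solve-∀

-- Integer roots and the inclusion probability

^-distribʳ-* : ∀ m n k → (m * n) ^ k ≡ m ^ k * n ^ k
^-distribʳ-* m n zero    = refl
^-distribʳ-* m n (suc k) = begin
    m * n * (m * n) ^ k
  ≡⟨ cong (m * n *_) (^-distribʳ-* m n k) ⟩
    m * n * (m ^ k * n ^ k)
  ≡⟨ interchange m n (m ^ k) (n ^ k) ⟩
    m * m ^ k * (n * n ^ k) ∎
  where
  open ≡-Reasoning
  interchange : ∀ x y u v → x * y * (u * v) ≡ x * u * (y * v)
  interchange = solve-∀

[1+c]^[1+k]≤c^[1+k]+[1+k]*[1+c]^k : ∀ c k → suc c ^ suc k ≤ c ^ suc k + suc k * suc c ^ k
[1+c]^[1+k]≤c^[1+k]+[1+k]*[1+c]^k c zero = ≤-reflexive (identity c)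
  where
  identity : ∀ c → suc c * 1 ≡ c * 1 + 1 * 1
  identity = solve-∀
[1+c]^[1+k]≤c^[1+k]+[1+k]*[1+c]^k c (suc k) = begin
    suc c * suc c ^ suc k
  ≤⟨ *-monoʳ-≤ (suc c) ([1+c]^[1+k]≤c^[1+k]+[1+k]*[1+c]^k c k) ⟩
    suc c * (p + suc k * q)
  ≡⟨ expand c p (suc k) q ⟩
    c * p + p + suc k * (suc c * q)
  ≤⟨ +-monoˡ-≤ _ (+-monoʳ-≤ (c * p) (^-monoˡ-≤ (suc k) (n≤1+n c))) ⟩
    c * p + suc c * q + suc k * (suc c * q)
  ≡⟨ +-assoc (c * p) (suc c * q) _ ⟩
    c * p + suc (suc k) * (suc c * q) ∎
  where
  open ≤-Reasoning
  p = c ^ suc k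
  q = suc c ^ k
  expand : ∀ c p a q → suc c * (p + a * q) ≡ c * p + p + a * (suc c * q)
  expand = solve-∀

threshold-crossing : ∀ (f : ℕ → ℕ) {T} m → f 0 < T → T ≤ f m → ∃[ c ] f c < T × T ≤ f (suc c)
threshold-crossing f zero        f0<T T≤f0 = ⊥-elim (<⇒≱ f0<T T≤f0)
threshold-crossing f {T} (suc m) f0<T T≤f[1+m] with T ≤? f m
... | yes T≤fm = threshold-crossing f m f0<T T≤fm
... | no  T≰fm = m , ≰⇒> T≰fm , T≤f[1+m]

integer-root : ∀ k T → 1 ≤ k → 1 ≤ T → ∃[ c ] c ^ k < T × T ≤ suc c ^ k
integer-root (suc k) (suc t) _ _ =
  threshold-crossing (_^ suc k) (suc t) z<s (m≤m*n (suc t) (suc t ^ k) {{m^n≢0 (suc t) k}})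

-- The rounding error of the integer root: (b / (b - 1))^k < (r + 1) / r once b > k (r + 1).
rounding-slack : ∀ k c r → 1 ≤ k → k * suc r < suc c → suc c ^ k * r < c ^ k * suc r
rounding-slack (suc k) c r _ k*[1+r]<b = +-cancelʳ-< (K * suc r * q) _ _ (begin-strict
    b ^ K * r + K * suc r * q
  <⟨ +-monoʳ-< (b ^ K * r) (*-monoˡ-< q {{>-nonZero (m^n>0 b k)}} k*[1+r]<b) ⟩
    b ^ K * r + b * q
  ≡⟨ +-comm (b ^ K * r) (b ^ K) ⟩
    b ^ K + b ^ K * r
  ≡⟨ sym (*-suc (b ^ K) r) ⟩
    b ^ K * suc r
  ≤⟨ *-monoˡ-≤ (suc r) ([1+c]^[1+k]≤c^[1+k]+[1+k]*[1+c]^k c k) ⟩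
    (c ^ K + K * q) * suc r
  ≡⟨ distribute (c ^ K) K q (suc r) ⟩
    c ^ K * suc r + K * suc r * q ∎)
  where
  open ≤-Reasoning
  K = suc k
  b = suc c
  q = b ^ k
  distribute : ∀ x K q r → (x + K * q) * r ≡ x * r + K * r * q
  distribute = solve-∀

-- The rational a / b approximates the optimal probability ((k + 1) A)^(-1/k) from below, closely
-- enough that the rounding error is absorbed by the strict inequality defining e.
near-optimal-probability : ∀ k D A → 1 ≤ k → 1 ≤ A → A * suc k ! ≤ D ^ suc k →
  ∃[ a ] ∃[ b ] ∃[ N ] a ≤ b × suc k * A * a ^ k ≤ b ^ k ×
    (suc k * b) ^ k * N ! < a ^ k * (D ^ suc k * expNum k N)
near-optimal-probability k@(suc _) D A 1≤k 1≤A A*[1+k]!≤D^[1+k] = a , b , N , a≤b , T≤b^k , bound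
  where
  N = suc k
  E = expNum k N
  r = suc k ^ k * N !
  a = suc (k * suc r)
  T = suc k * A * a ^ k
  a^k≤T : a ^ k ≤ T
  a^k≤T = m≤n*m (a ^ k) (suc k * A) {{>-nonZero (*-mono-≤ (s≤s (z≤n {k})) 1≤A)}}
  root = integer-root k T 1≤k (≤-trans (m^n>0 a k) a^k≤T)
  c = proj₁ root
  b = suc c
  c^k<T : c ^ k < T
  c^k<T = proj₁ (proj₂ root)
  T≤b^k : T ≤ b ^ k
  T≤b^k = proj₂ (proj₂ root)
  a≤b : a ≤ b
  a≤b = ≮⇒≥ (λ b<a → <⇒≱ (^-monoˡ-< k b<a) (≤-trans a^k≤T T≤b^k))
  bound : (suc k * b) ^ k * N ! < a ^ k * (D ^ suc k * E)
  bound = begin-strict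
      (suc k * b) ^ k * N !
    ≡⟨ cong (_* N !) (^-distribʳ-* (suc k) b k) ⟩
      suc k ^ k * b ^ k * N !
    ≡⟨ rearrange (suc k ^ k) (b ^ k) (N !) ⟩
      b ^ k * r
    <⟨ rounding-slack k c r 1≤k a≤b ⟩
      c ^ k * suc r
    ≤⟨ *-monoʳ-≤ (c ^ k) ([1+k]^k*[1+k]!<k!*expNum k 1≤k) ⟩
      c ^ k * (k ! * E)
    ≤⟨ *-monoˡ-≤ (k ! * E) (<⇒≤ c^k<T) ⟩
      T * (k ! * E)
    ≡⟨ regroup (suc k) A (a ^ k) (k !) E ⟩
      a ^ k * (A * suc k !) * E
    ≤⟨ *-monoˡ-≤ E (*-monoʳ-≤ (a ^ k) A*[1+k]!≤D^[1+k]) ⟩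
      a ^ k * D ^ suc k * E
    ≡⟨ *-assoc (a ^ k) (D ^ suc k) E ⟩
      a ^ k * (D ^ suc k * E) ∎
    where
    open ≤-Reasoning
    rearrange : ∀ x y z → x * y * z ≡ y * (x * z)
    rearrange = solve-∀
    regroup : ∀ s A x f E → s * A * x * (f * E) ≡ x * (A * (s * f)) * E
    regroup = solve-∀

-- Multiaffine functions

Multiaffine : ∀ m → (Vec ℕ m → ℕ) → Set
Multiaffine zero    F = ⊤
Multiaffine (suc m) F =
  Σ (Vec ℕ m → ℕ) λ α → Σ (Vec ℕ m → ℕ) λ β →
    Multiaffine m α × Multiaffine m β × (∀ t xs → F (t ∷ xs) ≡ α xs + β xs * t)

Multiaffine-cong : ∀ {m} {F G : Vec ℕ m → ℕ} → (∀ xs → F xs ≡ G xs) → Multiaffine m F → Multiaffine m G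
Multiaffine-cong {zero}  F≗G _ = tt
Multiaffine-cong {suc m} F≗G (α , β , mα , mβ , F≡) =
  α , β , mα , mβ , λ t xs → trans (sym (F≗G (t ∷ xs))) (F≡ t xs)

Multiaffine-const : ∀ {m} c → Multiaffine m (λ _ → c)
Multiaffine-const {zero}  c = tt
Multiaffine-const {suc m} c =
  (λ _ → c) , (λ _ → 0) , Multiaffine-const c , Multiaffine-const 0 , λ _ _ → sym (+-identityʳ c)

Multiaffine-+ : ∀ {m} {F G : Vec ℕ m → ℕ} → Multiaffine m F → Multiaffine m G →
  Multiaffine m (λ xs → F xs + G xs)
Multiaffine-+ {zero} _ _ = tt
Multiaffine-+ {suc m} (α , β , mα , mβ , F≡) (γ , δ , mγ , mδ , G≡) =
  (λ xs → α xs + γ xs) , (λ xs → β xs + δ xs) , Multiaffine-+ mα mγ , Multiaffine-+ mβ mδ ,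
  λ t xs → trans (cong₂ _+_ (F≡ t xs) (G≡ t xs)) (regroup (α xs) (β xs) (γ xs) (δ xs) t)
  where
  regroup : ∀ a b c d t → a + b * t + (c + d * t) ≡ a + c + (b + d) * t
  regroup = solve-∀

Multiaffine-*ˡ : ∀ {m} c {F : Vec ℕ m → ℕ} → Multiaffine m F → Multiaffine m (λ xs → c * F xs)
Multiaffine-*ˡ {zero}  c _ = tt
Multiaffine-*ˡ {suc m} c (α , β , mα , mβ , F≡) =
  (λ xs → c * α xs) , (λ xs → c * β xs) , Multiaffine-*ˡ c mα , Multiaffine-*ˡ c mβ ,
  λ t xs → trans (cong (c *_) (F≡ t xs)) (distribute c (α xs) (β xs) t)
  where
  distribute : ∀ c a b t → c * (a + b * t) ≡ c * a + c * b * t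
  distribute = solve-∀

Multiaffine-fix : ∀ {m} {F : Vec ℕ (suc m) → ℕ} → Multiaffine (suc m) F → ∀ t →
  Multiaffine m (λ xs → F (t ∷ xs))
Multiaffine-fix (α , β , mα , mβ , F≡) t =
  Multiaffine-cong (λ xs → trans (cong (α xs +_) (*-comm t (β xs))) (sym (F≡ t xs)))
    (Multiaffine-+ mα (Multiaffine-*ˡ t mβ))

Multiaffine-sum : ∀ {m} → Multiaffine m Vec.sum
Multiaffine-sum {zero}  = tt
Multiaffine-sum {suc m} =
  Vec.sum , (λ _ → 1) , Multiaffine-sum , Multiaffine-const 1 ,
  λ t xs → trans (+-comm t (Vec.sum xs)) (cong (Vec.sum xs +_) (sym (*-identityˡ t)))

Multiaffine-∑ : ∀ {m N} (f : Fin N → Vec ℕ m → ℕ) → (∀ w → Multiaffine m (f w)) →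
  Multiaffine m (λ xs → ∑[ w < N ] f w xs)
Multiaffine-∑ {N = zero}  f _  = Multiaffine-const 0
Multiaffine-∑ {N = suc N} f mf = Multiaffine-+ (mf zero) (Multiaffine-∑ (f ∘ suc) (mf ∘ suc))

esym : ∀ {m} → ℕ → Subset m → Vec ℕ m → ℕ
esym zero    _            _        = 1
esym (suc j) []           []       = 0
esym (suc j) (inside ∷ S)  (x ∷ xs) = x * esym j S xs + esym (suc j) S xs
esym (suc j) (outside ∷ S) (x ∷ xs) = esym (suc j) S xs

Multiaffine-esym : ∀ {m} j (S : Subset m) → Multiaffine m (esym j S)
Multiaffine-esym {zero}  j       S             = tt
Multiaffine-esym {suc m} zero    S             = Multiaffine-const 1
Multiaffine-esym {suc m} (suc j) (inside ∷ S)  =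
  esym (suc j) S , esym j S , Multiaffine-esym (suc j) S , Multiaffine-esym j S ,
  λ t xs → trans (+-comm (t * esym j S xs) _) (cong (esym (suc j) S xs +_) (*-comm t (esym j S xs)))
Multiaffine-esym {suc m} (suc j) (outside ∷ S) =
  esym (suc j) S , (λ _ → 0) , Multiaffine-esym (suc j) S , Multiaffine-const 0 ,
  λ _ _ → sym (+-identityʳ _)

select : ℕ → Side → ℕ
select b inside  = b
select b outside = 0

scaledIndicator : ∀ {m} → ℕ → Subset m → Vec ℕ m
scaledIndicator b = Vec.map (select b)

sum-replicate : ∀ m c → Vec.sum (replicate m c) ≡ m * c
sum-replicate zero    c = refl
sum-replicate (suc m) c = cong (c +_) (sum-replicate m c)

sum-scaledIndicator : ∀ {m} c (R : Subset m) → Vec.sum (scaledIndicator c R) ≡ c * ∣ R ∣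
sum-scaledIndicator c []            = sym (*-zeroʳ c)
sum-scaledIndicator c (inside ∷ R)  = trans (cong (c +_) (sum-scaledIndicator c R)) (sym (*-suc c ∣ R ∣))
sum-scaledIndicator c (outside ∷ R) = sum-scaledIndicator c R

esym-replicate : ∀ {m} j (S : Subset m) c → esym j S (replicate m c) ≡ c ^ j * (∣ S ∣ C j)
esym-replicate zero    S             c = refl
esym-replicate (suc j) []            c = sym (*-zeroʳ (c ^ suc j))
esym-replicate (suc j) (inside ∷ S)  c
  rewrite esym-replicate j S c | esym-replicate (suc j) S c | C-suc-suc ∣ S ∣ j
  = factor c (c ^ j) _ _
  where
  factor : ∀ c x u v → c * (x * u) + c * x * v ≡ c * x * (u + v)
  factor = solve-∀
esym-replicate (suc j) (outside ∷ S) c = esym-replicate (suc j) S c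

esym-scaledIndicator : ∀ {m} j (S R : Subset m) c →
  esym j S (scaledIndicator c R) ≡ c ^ j * (∣ S ∩ R ∣ C j)
esym-scaledIndicator zero    S             R              c = refl
esym-scaledIndicator (suc j) []            []             c = sym (*-zeroʳ (c ^ suc j))
esym-scaledIndicator (suc j) (inside ∷ S)  (inside ∷ R)   c
  rewrite esym-scaledIndicator j S R c | esym-scaledIndicator (suc j) S R c | C-suc-suc ∣ S ∩ R ∣ j
  = factor c (c ^ j) _ _
  where
  factor : ∀ c x u v → c * (x * u) + c * x * v ≡ c * x * (u + v)
  factor = solve-∀
esym-scaledIndicator (suc j) (inside ∷ S)  (outside ∷ R)  c = esym-scaledIndicator (suc j) S R c
esym-scaledIndicator (suc j) (outside ∷ S) (_ ∷ R)        c = esym-scaledIndicator (suc j) S R c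

affine-exchange : ∀ {a b} → a ≤ b → ∀ α β γ δ →
  ∃[ s ] (α + β * a) + (γ + δ * select b s) ≤ (α + β * select b s) + (γ + δ * a)
affine-exchange {a} a≤b α β γ δ with m≤n⇒∃[o]m+o≡n a≤b | δ ≤? β
... | d , refl | yes δ≤β = inside , (begin
    (α + β * a) + (γ + δ * (a + d))
  ≡⟨ expandˡ α β γ δ a d ⟩
    (α + γ + β * a + δ * a) + δ * d
  ≤⟨ +-monoʳ-≤ (α + γ + β * a + δ * a) (*-monoˡ-≤ d δ≤β) ⟩
    (α + γ + β * a + δ * a) + β * d
  ≡⟨ expandʳ α β γ δ a d ⟩
    (α + β * (a + d)) + (γ + δ * a) ∎)
  where
  open ≤-Reasoning
  expandˡ : ∀ α β γ δ a d → (α + β * a) + (γ + δ * (a + d)) ≡ (α + γ + β * a + δ * a) + δ * d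
  expandˡ = solve-∀
  expandʳ : ∀ α β γ δ a d → (α + γ + β * a + δ * a) + β * d ≡ (α + β * (a + d)) + (γ + δ * a)
  expandʳ = solve-∀
... | d , refl | no δ≰β = outside , (begin
    (α + β * a) + (γ + δ * 0)
  ≡⟨ expandˡ α β γ δ a ⟩
    (α + γ) + β * a
  ≤⟨ +-monoʳ-≤ (α + γ) (*-monoˡ-≤ a (<⇒≤ (≰⇒> δ≰β))) ⟩
    (α + γ) + δ * a
  ≡⟨ expandʳ α β γ δ a ⟩
    (α + β * 0) + (γ + δ * a) ∎)
  where
  open ≤-Reasoning
  expandˡ : ∀ α β γ δ a → (α + β * a) + (γ + δ * 0) ≡ (α + γ) + β * a
  expandˡ = solve-∀
  expandʳ : ∀ α β γ δ a → (α + γ) + δ * a ≡ (α + β * 0) + (γ + δ * a)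
  expandʳ = solve-∀

exchange-trans : ∀ {x y z w u v} → x + y ≤ z + w → z + u ≤ v + y → x + u ≤ v + w
exchange-trans {x} {y} {z} {w} {u} {v} x+y≤z+w z+u≤v+y = +-cancelʳ-≤ (y + z) (x + u) (v + w) (begin
    x + u + (y + z)
  ≡⟨ shuffleˡ x u y z ⟩
    (x + y) + (z + u)
  ≤⟨ +-mono-≤ x+y≤z+w z+u≤v+y ⟩
    (z + w) + (v + y)
  ≡⟨ shuffleʳ z w v y ⟩
    v + w + (y + z) ∎)
  where
  open ≤-Reasoning
  shuffleˡ : ∀ x u y z → x + u + (y + z) ≡ (x + y) + (z + u)
  shuffleˡ = solve-∀
  shuffleʳ : ∀ z w v y → (z + w) + (v + y) ≡ v + w + (y + z)
  shuffleʳ = solve-∀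

-- F p + G q ≤ F q + G p expresses (F - G) p ≤ (F - G) q without truncated subtraction.  Since
-- F - G is affine in each coordinate, moving one coordinate from a to 0 or to b does not decrease it:
-- this is the method of conditional expectations for inclusion probability a / b.
multiaffine-rounding : ∀ {m a b} → a ≤ b → (F G : Vec ℕ m → ℕ) → Multiaffine m F → Multiaffine m G →
  ∃[ R ] F (replicate m a) + G (scaledIndicator b R) ≤ F (scaledIndicator b R) + G (replicate m a)
multiaffine-rounding {zero} _ _ _ _ _ = [] , ≤-refl
multiaffine-rounding {suc m} {a} {b} a≤b F G mF@(α , β , _ , _ , F≡) mG@(γ , δ , _ , _ , G≡) =
  s ∷ proj₁ rest , exchange-trans {y = G (t ∷ x)} {z = F (t ∷ x)} first-coordinate (proj₂ rest)
  where
  x = replicate m a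
  exchange = affine-exchange a≤b (α x) (β x) (γ x) (δ x)
  s = proj₁ exchange
  t = select b s
  first-coordinate : F (a ∷ x) + G (t ∷ x) ≤ F (t ∷ x) + G (a ∷ x)
  first-coordinate =
    subst₂ _≤_ (sym (cong₂ _+_ (F≡ a x) (G≡ t x))) (sym (cong₂ _+_ (F≡ t x) (G≡ a x))) (proj₂ exchange)
  rest = multiaffine-rounding a≤b (λ xs → F (t ∷ xs)) (λ xs → G (t ∷ xs))
    (Multiaffine-fix {F = F} mF t) (Multiaffine-fix {F = G} mG t)

∑-mono-≤ : ∀ {N} {f g : Fin N → ℕ} → (∀ i → f i ≤ g i) → ∑[ i < N ] f i ≤ ∑[ i < N ] g i
∑-mono-≤ {zero}  _   = z≤n
∑-mono-≤ {suc N} f≤g = +-mono-≤ (f≤g zero) (∑-mono-≤ (f≤g ∘ suc))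

∑-mono-< : ∀ {N} {f g : Fin N → ℕ} → (∀ i → f i ≤ g i) → ∀ j → f j < g j →
  ∑[ i < N ] f i < ∑[ i < N ] g i
∑-mono-< f≤g zero    fj<gj = +-mono-<-≤ fj<gj (∑-mono-≤ (f≤g ∘ suc))
∑-mono-< f≤g (suc j) fj<gj = +-mono-≤-< (f≤g zero) (∑-mono-< (f≤g ∘ suc) j fj<gj)

∑-const : ∀ N c → ∑[ i < N ] c ≡ N * c
∑-const zero    c = refl
∑-const (suc N) c = cong (c +_) (∑-const N c)

∣p∪q∣≤∣p∣+∣q∣ : ∀ {m} (p q : Subset m) → ∣ p ∪ q ∣ ≤ ∣ p ∣ + ∣ q ∣
∣p∪q∣≤∣p∣+∣q∣ []            []            = z≤n
∣p∪q∣≤∣p∣+∣q∣ (inside ∷ p)  (inside ∷ q)  = s≤s (≤-trans (∣p∪q∣≤∣p∣+∣q∣ p q) (+-monoʳ-≤ ∣ p ∣ (n≤1+n _)))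
∣p∪q∣≤∣p∣+∣q∣ (inside ∷ p)  (outside ∷ q) = s≤s (∣p∪q∣≤∣p∣+∣q∣ p q)
∣p∪q∣≤∣p∣+∣q∣ (outside ∷ p) (inside ∷ q)  =
  subst (suc ∣ p ∪ q ∣ ≤_) (sym (+-suc ∣ p ∣ ∣ q ∣)) (s≤s (∣p∪q∣≤∣p∣+∣q∣ p q))
∣p∪q∣≤∣p∣+∣q∣ (outside ∷ p) (outside ∷ q) = ∣p∪q∣≤∣p∣+∣q∣ p q

x∈p⇒∣p∣≡1+∣p-x∣ : ∀ {m} {p : Subset m} {x} → x ∈ p → ∣ p ∣ ≡ suc ∣ p - x ∣
x∈p⇒∣p∣≡1+∣p-x∣ {p = p} {x} x∈p = ≤-antisym ∣p∣≤1+∣p-x∣ (x∈p⇒∣p-x∣<∣p∣ x∈p)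
  where
  p⊆[p-x]∪⁅x⁆ : ∀ {y} → y ∈ p → y ∈ (p - x) ∪ ⁅ x ⁆
  p⊆[p-x]∪⁅x⁆ {y} y∈p with y ≟ᶠ x
  ... | yes refl = q⊆p∪q (p - x) ⁅ x ⁆ (x∈⁅x⁆ x)
  ... | no  y≢x  = p⊆p∪q ⁅ x ⁆ (x∈p∧x≢y⇒x∈p-y y∈p y≢x)
  ∣p∣≤1+∣p-x∣ : ∣ p ∣ ≤ suc ∣ p - x ∣
  ∣p∣≤1+∣p-x∣ = begin
      ∣ p ∣
    ≤⟨ p⊆q⇒∣p∣≤∣q∣ p⊆[p-x]∪⁅x⁆ ⟩
      ∣ (p - x) ∪ ⁅ x ⁆ ∣
    ≤⟨ ∣p∪q∣≤∣p∣+∣q∣ (p - x) ⁅ x ⁆ ⟩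
      ∣ p - x ∣ + ∣ ⁅ x ⁆ ∣
    ≡⟨ cong (∣ p - x ∣ +_) (∣⁅x⁆∣≡1 x) ⟩
      ∣ p - x ∣ + 1
    ≡⟨ +-comm ∣ p - x ∣ 1 ⟩
      suc ∣ p - x ∣ ∎
    where open ≤-Reasoning

∣p∣>0⇒Nonempty : ∀ {m} (p : Subset m) → 0 < ∣ p ∣ → Nonempty p
∣p∣>0⇒Nonempty {m} p ∣p∣>0 with nonempty? p
... | yes ne = ne
... | no ¬ne = contradiction (trans (cong ∣_∣ (Empty-unique ¬ne)) (∣⊥∣≡0 m)) (>⇒≢ ∣p∣>0)

p∩[q─r]≡[p∩q]─r : ∀ {m} (p q r : Subset m) → p ∩ (q ─ r) ≡ (p ∩ q) ─ r
p∩[q─r]≡[p∩q]─r []            []      []            = refl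
p∩[q─r]≡[p∩q]─r (inside ∷ p)  (y ∷ q) (inside ∷ r)  = cong (outside ∷_) (p∩[q─r]≡[p∩q]─r p q r)
p∩[q─r]≡[p∩q]─r (inside ∷ p)  (y ∷ q) (outside ∷ r) = cong (y ∷_) (p∩[q─r]≡[p∩q]─r p q r)
p∩[q─r]≡[p∩q]─r (outside ∷ p) (y ∷ q) (inside ∷ r)  = cong (outside ∷_) (p∩[q─r]≡[p∩q]─r p q r)
p∩[q─r]≡[p∩q]─r (outside ∷ p) (y ∷ q) (outside ∷ r) = cong (outside ∷_) (p∩[q─r]≡[p∩q]─r p q r)

-- The alteration method

∈⇒≤foldr-⊔ : ∀ {x xs} → x ∈ˡ xs → x ≤ foldr _⊔_ 0 xs
∈⇒≤foldr-⊔ (here refl)  = m≤m⊔n _ _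
∈⇒≤foldr-⊔ (there x∈ys) = ≤-trans (∈⇒≤foldr-⊔ x∈ys) (m≤n⊔m _ _)

degree≤maxDegree : ∀ {n} (G : Graph n) v → degree G v ≤ maxDegree G
degree≤maxDegree G v = ∈⇒≤foldr-⊔ (∈-map⁺ (degree G) (∈-allFin v))

∣closedNbhd∣≤1+maxDegree : ∀ {n} (G : Graph n) v → ∣ closedNbhd G v ∣ ≤ suc (maxDegree G)
∣closedNbhd∣≤1+maxDegree G v = ≤-trans (∣p∪q∣≤∣p∣+∣q∣ ⁅ v ⁆ (nbhd G v))
  (subst (λ d → d + degree G v ≤ suc (maxDegree G)) (sym (∣⁅x⁆∣≡1 v)) (s≤s (degree≤maxDegree G v)))

-- The number of pairs (w, Y) with Y a (k + 1)-element subset of N[w] ∩ R; each such pair witnesses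
-- a violation of k-limitedness at w.
excess : ∀ {n} → Graph n → ℕ → Subset n → ℕ
excess {n} G k R = ∑[ w < n ] (∣ closedNbhd G w ∩ R ∣ C suc k)

excess-removal : ∀ {n} (G : Graph n) k (R : Subset n) {w u} → k < ∣ closedNbhd G w ∩ R ∣ →
  u ∈ closedNbhd G w ∩ R → excess G k (R - u) < excess G k R
excess-removal G k R {w} {u} k<∣N∩R∣ u∈N∩R = ∑-mono-< shrinks w (subst (_< _) (sym (removed w)) strict)
  where
  removed : ∀ v → ∣ closedNbhd G v ∩ (R - u) ∣ C suc k ≡ ∣ (closedNbhd G v ∩ R) - u ∣ C suc k
  removed v = cong (λ S → ∣ S ∣ C suc k) (p∩[q─r]≡[p∩q]─r (closedNbhd G v) R ⁅ u ⁆)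
  shrinks : ∀ v → ∣ closedNbhd G v ∩ (R - u) ∣ C suc k ≤ ∣ closedNbhd G v ∩ R ∣ C suc k
  shrinks v = subst (_≤ _) (sym (removed v)) (C-monoˡ-≤ (suc k) (∣p─q∣≤∣p∣ (closedNbhd G v ∩ R) ⁅ u ⁆))
  ∣N∩R∣≡1+∣[N∩R]-u∣ = x∈p⇒∣p∣≡1+∣p-x∣ u∈N∩R
  strict : ∣ (closedNbhd G w ∩ R) - u ∣ C suc k < ∣ closedNbhd G w ∩ R ∣ C suc k
  strict = subst (λ m → ∣ (closedNbhd G w ∩ R) - u ∣ C suc k < m C suc k) (sym ∣N∩R∣≡1+∣[N∩R]-u∣)
    (k≤n⇒nC[1+k]<[1+n]C[1+k] (≤-pred (subst (k <_) ∣N∩R∣≡1+∣[N∩R]-u∣ k<∣N∩R∣)))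

alteration : ∀ {n} (G : Graph n) k (R : Subset n) →
  ∃[ X ] IsLimitedPacking G k X × ∣ R ∣ ≤ ∣ X ∣ + excess G k R
alteration G k R = go R (<-wellFounded ∣ R ∣)
  where
  go : ∀ R → Acc _<_ ∣ R ∣ → ∃[ X ] IsLimitedPacking G k X × ∣ R ∣ ≤ ∣ X ∣ + excess G k R
  go R (acc smaller) with all? (λ w → ∣ closedNbhd G w ∩ R ∣ ≤? k)
  ... | yes R-packing = R , R-packing , m≤m+n ∣ R ∣ _
  ... | no ¬R-packing with ¬∀⟶∃¬ _ _ (λ w → ∣ closedNbhd G w ∩ R ∣ ≤? k) ¬R-packing
  ...   | w , overfull with ≰⇒> overfull
  ...     | k<∣N∩R∣ with ∣p∣>0⇒Nonempty (closedNbhd G w ∩ R) (≤-trans (s≤s z≤n) k<∣N∩R∣)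
  ...       | u , u∈N∩R with go (R - u) (smaller (x∈p⇒∣p-x∣<∣p∣ (proj₂ (x∈p∩q⁻ _ R u∈N∩R))))
  ...         | X , X-packing , ∣R-u∣≤ = X , X-packing , (begin
      ∣ R ∣
    ≡⟨ x∈p⇒∣p∣≡1+∣p-x∣ (proj₂ (x∈p∩q⁻ _ R u∈N∩R)) ⟩
      suc ∣ R - u ∣
    ≤⟨ s≤s ∣R-u∣≤ ⟩
      suc (∣ X ∣ + excess G k (R - u))
    ≡⟨ sym (+-suc ∣ X ∣ _) ⟩
      ∣ X ∣ + suc (excess G k (R - u))
    ≤⟨ +-monoʳ-≤ ∣ X ∣ (excess-removal G k R k<∣N∩R∣ u∈N∩R) ⟩
      ∣ X ∣ + excess G k R ∎)
    where open ≤-Reasoning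

-- Choosing each vertex with probability a / b, the expected size of the random set is n a / b and its
-- expected excess is at most n C(Δ + 1, k + 1) (a / b)^(k + 1); the bound below clears denominators.
dense-limited-packing : ∀ {n} (G : Graph n) k {a b} → a ≤ b →
  ∃[ X ] IsLimitedPacking G k X ×
    b ^ k * (n * a) ≤ b ^ suc k * ∣ X ∣ + n * (a ^ suc k * (suc (maxDegree G) C suc k))
dense-limited-packing {n} G k {a} {b} a≤b =
  X , X-packing , +-cancelʳ-≤ (b ^ suc k * excess G k R) _ _ (begin
    b ^ k * (n * a) + b ^ suc k * excess G k R
  ≡⟨ cong₂ (λ s e → b ^ k * s + e) (sym (sum-replicate n a)) (sym violations-at-R) ⟩
    size (replicate n a) + violations (scaledIndicator b R)
  ≤⟨ R-rounds ⟩
    size (scaledIndicator b R) + violations (replicate n a)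
  ≤⟨ +-monoʳ-≤ (size (scaledIndicator b R)) violations-at-a ⟩
    b ^ k * Vec.sum (scaledIndicator b R) + n * (a ^ suc k * A)
  ≡⟨ cong (λ s → b ^ k * s + n * (a ^ suc k * A)) (sum-scaledIndicator b R) ⟩
    b ^ k * (b * ∣ R ∣) + n * (a ^ suc k * A)
  ≤⟨ +-monoˡ-≤ _ (*-monoʳ-≤ (b ^ k) (*-monoʳ-≤ b ∣R∣≤∣X∣+excess)) ⟩
    b ^ k * (b * (∣ X ∣ + excess G k R)) + n * (a ^ suc k * A)
  ≡⟨ distribute (b ^ k) b ∣ X ∣ (excess G k R) (n * (a ^ suc k * A)) ⟩
    b ^ suc k * ∣ X ∣ + n * (a ^ suc k * A) + b ^ suc k * excess G k R ∎)
  where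
  open ≤-Reasoning
  A = suc (maxDegree G) C suc k
  size : Vec ℕ n → ℕ
  size s = b ^ k * Vec.sum s
  violations : Vec ℕ n → ℕ
  violations s = ∑[ w < n ] esym (suc k) (closedNbhd G w) s
  rounding = multiaffine-rounding a≤b size violations (Multiaffine-*ˡ (b ^ k) Multiaffine-sum)
    (Multiaffine-∑ (λ w → esym (suc k) (closedNbhd G w)) (λ w → Multiaffine-esym (suc k) (closedNbhd G w)))
  R = proj₁ rounding
  R-rounds = proj₂ rounding
  altered = alteration G k R
  X = proj₁ altered
  X-packing = proj₁ (proj₂ altered)
  ∣R∣≤∣X∣+excess = proj₂ (proj₂ altered)
  violations-at-R : violations (scaledIndicator b R) ≡ b ^ suc k * excess G k R
  violations-at-R = trans (sum-cong-≗ (λ w → esym-scaledIndicator (suc k) (closedNbhd G w) R b))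
    (sym (*-distribˡ-sum (b ^ suc k) (λ w → ∣ closedNbhd G w ∩ R ∣ C suc k)))
  violations-at-a : violations (replicate n a) ≤ n * (a ^ suc k * A)
  violations-at-a = begin
      violations (replicate n a)
    ≡⟨ sum-cong-≗ (λ w → esym-replicate (suc k) (closedNbhd G w) a) ⟩
      ∑[ w < n ] (a ^ suc k * (∣ closedNbhd G w ∣ C suc k))
    ≤⟨ ∑-mono-≤ (λ w → *-monoʳ-≤ (a ^ suc k) (C-monoˡ-≤ (suc k) (∣closedNbhd∣≤1+maxDegree G w))) ⟩
      ∑[ w < n ] (a ^ suc k * A)
    ≡⟨ ∑-const n (a ^ suc k * A) ⟩
      n * (a ^ suc k * A) ∎
  distribute : ∀ c b x e t → c * (b * (x + e)) + t ≡ b * c * x + t + b * c * e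
  distribute = solve-∀

packing-size-bound : ∀ k n A {a b x} → a ≤ b →
  b ^ k * (n * a) ≤ b ^ suc k * x + n * (a ^ suc k * A) → suc k * A * a ^ k ≤ b ^ k →
  k * n * a ≤ suc k * b * x
packing-size-bound k n A {zero} {b} {x} _ _ _ = subst (_≤ suc k * b * x) (sym (*-zeroʳ (k * n))) z≤n
packing-size-bound k n A {a} {b@(suc _)} {x} _ size-bound cap =
  *-cancelˡ-≤ (b ^ k) {{m^n≢0 b k}} (+-cancelʳ-≤ (b ^ k * (n * a)) _ _ (begin
    b ^ k * (k * n * a) + b ^ k * (n * a)
  ≡⟨ collect (b ^ k) k n a ⟩
    suc k * (b ^ k * (n * a))
  ≤⟨ *-monoʳ-≤ (suc k) size-bound ⟩
    suc k * (b * b ^ k * x + n * (a * a ^ k * A))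
  ≡⟨ expand (suc k) b (b ^ k) x n a (a ^ k) A ⟩
    b ^ k * (suc k * b * x) + n * a * (suc k * A * a ^ k)
  ≤⟨ +-monoʳ-≤ (b ^ k * (suc k * b * x)) (*-monoʳ-≤ (n * a) cap) ⟩
    b ^ k * (suc k * b * x) + n * a * b ^ k
  ≡⟨ cong (b ^ k * (suc k * b * x) +_) (*-comm (n * a) (b ^ k)) ⟩
    b ^ k * (suc k * b * x) + b ^ k * (n * a) ∎))
  where
  open ≤-Reasoning
  collect : ∀ c k n a → c * (k * n * a) + c * (n * a) ≡ suc k * (c * (n * a))
  collect = solve-∀
  expand : ∀ s b c x n a d A → s * (b * c * x + n * (a * d * A)) ≡ c * (s * b * x) + n * a * (s * A * d)
  expand = solve-∀

ratio-^-< : ∀ k {u v a x P Q} → 0 < u → u * a ≤ v * x → v ^ k * P < a ^ k * Q → u ^ k * P < x ^ k * Q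
ratio-^-< k {u} {v} {a} {x} {P} {Q} u>0 ua≤vx vP<aQ =
  *-cancelˡ-< (v ^ k) (u ^ k * P) (x ^ k * Q) (begin-strict
    v ^ k * (u ^ k * P)
  ≡⟨ swap (v ^ k) (u ^ k) P ⟩
    u ^ k * (v ^ k * P)
  <⟨ *-monoʳ-< (u ^ k) {{>-nonZero (m^n>0 u {{>-nonZero u>0}} k)}} vP<aQ ⟩
    u ^ k * (a ^ k * Q)
  ≡⟨ sym (*-assoc (u ^ k) (a ^ k) Q) ⟩
    u ^ k * a ^ k * Q
  ≡⟨ cong (_* Q) (sym (^-distribʳ-* u a k)) ⟩
    (u * a) ^ k * Q
  ≤⟨ *-monoˡ-≤ Q (^-monoˡ-≤ k ua≤vx) ⟩
    (v * x) ^ k * Q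
  ≡⟨ cong (_* Q) (^-distribʳ-* v x k) ⟩
    v ^ k * x ^ k * Q
  ≡⟨ *-assoc (v ^ k) (x ^ k) Q ⟩
    v ^ k * (x ^ k * Q) ∎)
  where
  open ≤-Reasoning
  swap : ∀ c d e → c * (d * e) ≡ d * (c * e)
  swap = solve-∀

limited-packing-estimate : ∀ k n {D a b N x} → 0 < k * n → a ≤ b →
  suc k * (D C suc k) * a ^ k ≤ b ^ k → (suc k * b) ^ k * N ! < a ^ k * (D ^ suc k * expNum k N) →
  b ^ k * (n * a) ≤ b ^ suc k * x + n * (a ^ suc k * (D C suc k)) →
  LtTimesExp ((k * n) ^ k) (x ^ k * D ^ (k + 1)) k
limited-packing-estimate k n {D} {a} {b} {N} {x} kn>0 a≤b cap below-e size-bound = N , (begin-strict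
    (k * n) ^ k * N !
  <⟨ ratio-^-< k kn>0 (packing-size-bound k n (D C suc k) a≤b size-bound cap) below-e ⟩
    x ^ k * (D ^ suc k * expNum k N)
  ≡⟨ sym (*-assoc (x ^ k) (D ^ suc k) (expNum k N)) ⟩
    x ^ k * D ^ suc k * expNum k N
  ≡⟨ cong (λ e → x ^ k * D ^ e * expNum k N) (+-comm 1 k) ⟩
    x ^ k * D ^ (k + 1) * expNum k N ∎)
  where open ≤-Reasoning

corollary1 : ∀ {n} (G : Graph n) (k : ℕ) → 1 ≤ k → k ≤ maxDegree G →
    Σ (Subset n) (λ X → IsLimitedPacking G k X ×
      LtTimesExp ((k * n) ^ k) (∣ X ∣ ^ k * (1 + maxDegree G) ^ (k + 1)) k)
corollary1 {zero}  G (suc k) _ ()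
-- The witnesses are obtained by pattern matching: as where-bound projections they would be unfolded,
-- and the derandomisation evaluated, during conversion checking.
corollary1 {suc n} G k@(suc _) 1≤k k≤Δ =
  case near-optimal-probability k D A 1≤k (k≤n⇒nCk>0 (s≤s k≤Δ)) (nCk*k!≤n^k D (suc k)) of λ where
    (a , b , N , a≤b , cap , below-e) → case dense-limited-packing G k a≤b of λ where
      (X , X-packing , size-bound) →
        X , X-packing ,
        limited-packing-estimate k (suc n) {D} {a} {b} {N} {∣ X ∣} (s≤s z≤n) a≤b cap below-e size-bound
  where
  D = suc (maxDegree G)
  A = D C suc k
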